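{- Fix integers $\Delta\ge1$ and $q\geq 2\Delta+1$. Then there exists a constant $c>0$ such that for all sufficiently large $n$ and every vector $\vec n=(n_1,\dots,n_q)$ of nonnegative integers with $\|\vec n\|_1=n$ and $|n_i-\frac nq|\le cn$ for all $i\in[q]$, every graph $G$ of maximum degree $\Delta$ on $n$ vertices has an $\vec n$-coloring.
   Context: A (proper) $q$-coloring of $G=(V,E)$ is a map $\sigma:V\to[q]$ with $\sigma(u)\ne\sigma(v)$ for all edges $uv$. An $\vec n$-coloring is a proper $q$-coloring with exactly $n_i$ vertices of color $i$ for every $i\in[q]$. -}

module Defs where

open import Data.Nat using (ℕ; _+_; _*_; _≤_; _≥_; _<_; ∣_-_∣)
open import Data.Bool using (Bool; true; false; if_then_else_)
open import Data.Fin using (Fin; _≟_)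
open import Data.List using (List; map; allFin)
open import Data.Nat.ListAction using (sum)
open import Data.Product using (Σ; _×_; ∃; ∃-syntax)
open import Relation.Nullary using (¬_)
open import Relation.Nullary.Decidable using (⌊_⌋)
open import Relation.Binary.PropositionalEquality using (_≡_; _≢_)

record Graph (n : ℕ) : Set where
  field
    adj   : Fin n → Fin n → Bool
    sym   : ∀ u v → adj u v ≡ adj v u
    irrefl : ∀ v → adj v v ≡ false
open Graph public

countFin : (n : ℕ) → (Fin n → Bool) → ℕ
countFin n p = sum (map (λ u → if p u then 1 else 0) (allFin n))

degree : {n : ℕ} → Graph n → Fin n → ℕ
degree {n} G v = countFin n (adj G v)

HasMaxDegree : {n : ℕ} → Graph n → ℕ → Set
HasMaxDegree {n} G Δ = (∀ v → degree G v ≤ Δ) × (∃[ v ] degree G v ≡ Δ)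

IsProperColoring : {n : ℕ} (q : ℕ) → Graph n → (Fin n → Fin q) → Set
IsProperColoring q G σ = ∀ u v → adj G u v ≡ true → σ u ≢ σ v

colorClassSize : {n q : ℕ} → (Fin n → Fin q) → Fin q → ℕ
colorClassSize {n} σ i = countFin n (λ v → ⌊ σ v ≟ i ⌋)

IsVecColoring : {n q : ℕ} → Graph n → (Fin q → ℕ) → (Fin n → Fin q) → Set
IsVecColoring {q = q} G nv σ = IsProperColoring q G σ × (∀ i → colorClassSize σ i ≡ nv i)

l1 : (q : ℕ) → (Fin q → ℕ) → ℕ
l1 q nv = sum (map nv (allFin q))

-- |n_i - n/q| ≤ c n with c = a / b, multiplied through by q*b:
-- b * |q n_i - n| ≤ a * q * n
Balanced : (q n a b : ℕ) → (Fin q → ℕ) → Set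
Balanced q n a b nv = ∀ i → b * ∣ q * nv i - n ∣ ≤ a * q * n

-- Colour the vertices one at a time, keeping the class of every colour j of size at most n_j.
-- An uncoloured vertex v takes any colour that is unsaturated and absent from its neighbourhood.
-- If there is none, fix an unsaturated colour i.  Every colour absent around v is then saturated,
-- and as n_j ≤ n/(2Δ) for all j, the at most Δ neighbours of v block colours covering at most
-- n/2 vertices: so at least n/2 coloured vertices carry a colour absent around v.  Fewer than
-- Δ n_i ≤ n/2 vertices are adjacent to the class of i.  Hence some vertex w carries a colour
-- absent around v and has no neighbour coloured i; recolour w with i and give v the old colour
-- of w.  With c = 1/(2Δq) and q ≥ 2Δ+1 the balance condition gives n_j ≤ (2Δ+1)n/(2Δq) ≤ n/(2Δ)
-- for every n, so no lower bound on n is needed.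

module Submission where

open import Data.Bool using (Bool; true; false; not; _∧_; if_then_else_)
open import Data.Bool.Properties using (¬-not; ∧-assoc; ∧-identityʳ; ∧-zeroʳ) renaming (_≟_ to _≟ᴮ_)
open import Data.Fin using (Fin; zero; suc; _≟_)
open import Data.Fin.Properties using (any?; suc-injective)
open import Data.List using (allFin; tabulate) renaming (map to mapᴸ)
open import Data.List.Properties using (map-tabulate)
import Data.Nat.ListAction as ListAction
open import Data.Nat using (ℕ; zero; suc; _+_; _*_; _≤_; _<_; z≤n; s≤s; NonZero; _<?_; _≡ᵇ_; ∣_-_∣)
open import Data.Nat.Properties
  using ( ≤-refl; ≤-reflexive; ≤-trans; ≤-antisym; ≤-pred; <-irrefl; <-≤-trans; ≤-<-trans
        ; <⇒≢; <⇒≱; ≤⇒≯; ≮⇒≥; n≮0; m≤m+n; m≤n+m; m<m+n; m+n≡0⇒m≡0; m+n≡0⇒n≡0; m≤∣m-n∣+n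
        ; +-assoc; +-comm; +-identityʳ; +-mono-≤; +-mono-<-≤; +-mono-≤-<; +-monoˡ-≤; +-monoʳ-≤
        ; +-cancelʳ-≤; +-cancelʳ-≡
        ; *-assoc; *-identityˡ; *-identityʳ; *-zeroʳ; *-distribˡ-+; *-mono-≤; *-monoˡ-≤; *-monoʳ-≤
        ; *-monoʳ-<; *-cancelˡ-≤; *-cancelˡ-<
        ; +-commutativeSemigroup; +-*-semiring; module ≤-Reasoning )
  renaming (_≟_ to _≟ℕ_)
open import Data.Nat.Tactic.RingSolver using (solve-∀)
open import Data.Product using (∃-syntax; _×_; _,_)
open import Data.Vec.Functional using (updateAt)
open import Data.Vec.Functional.Properties using (updateAt-updates; updateAt-minimal)
open import Function using (_∘_; const; id)
open import Relation.Nullary using (yes; no; contradiction)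
open import Relation.Nullary.Decidable using (⌊_⌋; _×-dec_; isYes≗does; dec-true; dec-false)
open import Relation.Binary.PropositionalEquality
  using (_≡_; _≢_; _≗_; refl; sym; trans; cong; cong₂; subst; subst₂; module ≡-Reasoning)

open import Algebra.Properties.CommutativeSemigroup +-commutativeSemigroup using (xy∙z≈zy∙x; xy∙z≈xz∙y)
open import Algebra.Properties.Semiring.Sum +-*-semiring
  using (sum; sum-syntax; sum-cong-≗; sum-replicate-zero; ∑-comm; ∑-distrib-+; *-distribˡ-sum; *-distribʳ-sum)
open import Defs hiding (sym)

variable
  n q : ℕ

𝟙 : Bool → ℕ
𝟙 b = if b then 1 else 0

𝟙≤1 : ∀ b → 𝟙 b ≤ 1
𝟙≤1 false = z≤n
𝟙≤1 true  = ≤-refl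

𝟙-∧ : ∀ a b → 𝟙 (a ∧ b) ≡ 𝟙 a * 𝟙 b
𝟙-∧ false b = refl
𝟙-∧ true  b = sym (*-identityˡ (𝟙 b))

𝟙-∧-≤ˡ : ∀ a b → 𝟙 (a ∧ b) ≤ 𝟙 a
𝟙-∧-≤ˡ false b = z≤n
𝟙-∧-≤ˡ true  b = 𝟙≤1 b

sum-tabulate : (f : Fin n → ℕ) → ListAction.sum (tabulate f) ≡ sum f
sum-tabulate {zero}  f = refl
sum-tabulate {suc n} f = cong (f zero +_) (sum-tabulate (f ∘ suc))

sum-map-allFin : (f : Fin n → ℕ) → ListAction.sum (mapᴸ f (allFin n)) ≡ sum f
sum-map-allFin f = trans (cong ListAction.sum (map-tabulate id f)) (sum-tabulate f)

sum-const-1 : ∀ n → ∑[ i < n ] 1 ≡ n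
sum-const-1 zero    = refl
sum-const-1 (suc n) = cong suc (sum-const-1 n)

sum-mono-≤ : {f g : Fin n → ℕ} → (∀ i → f i ≤ g i) → sum f ≤ sum g
sum-mono-≤ {zero}  f≤g = z≤n
sum-mono-≤ {suc n} f≤g = +-mono-≤ (f≤g zero) (sum-mono-≤ (f≤g ∘ suc))

sum-mono-< : {f g : Fin n → ℕ} → (∀ i → f i ≤ g i) → ∀ i → f i < g i → sum f < sum g
sum-mono-< {suc n} f≤g zero    fi<gi = +-mono-<-≤ fi<gi (sum-mono-≤ (f≤g ∘ suc))
sum-mono-< {suc n} f≤g (suc i) fi<gi = +-mono-≤-< (f≤g zero) (sum-mono-< (f≤g ∘ suc) i fi<gi)

sum-<⇒∃-< : {f g : Fin n → ℕ} → sum f < sum g → ∃[ i ] f i < g i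
sum-<⇒∃-< {f = f} {g} ∑f<∑g with any? (λ i → f i <? g i)
... | yes found = found
... | no  none  = contradiction ∑f<∑g (≤⇒≯ (sum-mono-≤ (λ i → ≮⇒≥ (none ∘ (i ,_)))))

sum-mono-≡⇒≗ : {f g : Fin n → ℕ} → (∀ i → f i ≤ g i) → sum f ≡ sum g → f ≗ g
sum-mono-≡⇒≗ f≤g ∑f≡∑g i = ≤-antisym (f≤g i) (≮⇒≥ (λ fi<gi → <⇒≢ (sum-mono-< f≤g i fi<gi) ∑f≡∑g))

sum≡0⇒≡0 : {f : Fin n → ℕ} → sum f ≡ 0 → ∀ i → f i ≡ 0
sum≡0⇒≡0 {suc n} {f} ∑f≡0 zero    = m+n≡0⇒m≡0 (f zero) ∑f≡0
sum≡0⇒≡0 {suc n} {f} ∑f≡0 (suc i) = sum≡0⇒≡0 (m+n≡0⇒n≡0 (f zero) ∑f≡0) i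

sum-single : {f : Fin n → ℕ} (i : Fin n) → (∀ j → j ≢ i → f j ≡ 0) → sum f ≡ f i
sum-single {suc n} {f} zero    vanish = begin
  f zero + sum (f ∘ suc) ≡⟨ cong (f zero +_) (sum-cong-≗ {n} (λ j → vanish (suc j) λ ())) ⟩
  f zero + ∑[ j < n ] 0  ≡⟨ cong (f zero +_) (sum-replicate-zero n) ⟩
  f zero + 0             ≡⟨ +-identityʳ (f zero) ⟩
  f zero                 ∎
  where open ≡-Reasoning
sum-single {suc n} {f} (suc i) vanish =
  cong₂ _+_ (vanish zero λ ()) (sum-single i (λ j j≢i → vanish (suc j) (j≢i ∘ suc-injective)))

sum-update : {f g : Fin n → ℕ} (i : Fin n) → (∀ j → j ≢ i → g j ≡ f j) → sum g + f i ≡ sum f + g i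
sum-update {suc n} {f} {g} zero    agree = begin
  g zero + sum (g ∘ suc) + f zero
    ≡⟨ cong (λ s → g zero + s + f zero) (sum-cong-≗ {n} (λ j → agree (suc j) λ ())) ⟩
  g zero + sum (f ∘ suc) + f zero
    ≡⟨ xy∙z≈zy∙x (g zero) _ (f zero) ⟩
  f zero + sum (f ∘ suc) + g zero
    ∎
  where open ≡-Reasoning
sum-update {suc n} {f} {g} (suc i) agree = begin
  g zero + sum (g ∘ suc) + f (suc i)
    ≡⟨ +-assoc (g zero) _ _ ⟩
  g zero + (sum (g ∘ suc) + f (suc i))
    ≡⟨ cong₂ _+_ (agree zero λ ()) (sum-update i (λ j j≢i → agree (suc j) (j≢i ∘ suc-injective))) ⟩
  f zero + (sum (f ∘ suc) + g (suc i))
    ≡⟨ +-assoc (f zero) _ _ ⟨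
  f zero + sum (f ∘ suc) + g (suc i)
    ∎
  where open ≡-Reasoning

⌊≟⌋-≡ : {a b : Fin q} → a ≡ b → ⌊ a ≟ b ⌋ ≡ true
⌊≟⌋-≡ {a = a} {b} a≡b = trans (isYes≗does (a ≟ b)) (dec-true (a ≟ b) a≡b)

⌊≟⌋-≢ : {a b : Fin q} → a ≢ b → ⌊ a ≟ b ⌋ ≡ false
⌊≟⌋-≢ {a = a} {b} a≢b = trans (isYes≗does (a ≟ b)) (dec-false (a ≟ b) a≢b)

add-at-deficient : (s t : Fin q → ℕ) → (∀ k → s k ≤ t k) → ∀ i → s i < t i →
                   ∀ k → s k + 𝟙 ⌊ i ≟ k ⌋ ≤ t k
add-at-deficient s t s≤t i si<ti k with i ≟ k
... | yes refl = subst (_≤ t i) (+-comm 1 (s i)) si<ti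
... | no  _    = subst (_≤ t k) (sym (+-identityʳ (s k))) (s≤t k)

_[_]≔_ : {A : Set} → (Fin n → A) → Fin n → A → Fin n → A
f [ x ]≔ a = updateAt f x (const a)

-- A partial colouring is a pair (C, σ): C marks the coloured vertices, and σ is ignored off C.
module PartialColouring {n q : ℕ} (G : Graph n) where

  inClass : (Fin n → Bool) → (Fin n → Fin q) → Fin q → Fin n → Bool
  inClass C σ j u = C u ∧ ⌊ σ u ≟ j ⌋

  classSize : (Fin n → Bool) → (Fin n → Fin q) → Fin q → ℕ
  classSize C σ j = ∑[ u < n ] 𝟙 (inClass C σ j u)

  neighboursIn : (Fin n → Bool) → (Fin n → Fin q) → Fin n → Fin q → ℕ
  neighboursIn C σ x = classSize (λ u → adj G x u ∧ C u) σ

  uncoloured : (Fin n → Bool) → ℕ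
  uncoloured C = ∑[ u < n ] 𝟙 (not (C u))

  IsProperOn : (Fin n → Bool) → (Fin n → Fin q) → Set
  IsProperOn C σ = ∀ u w → C u ≡ true → C w ≡ true → adj G u w ≡ true → σ u ≢ σ w

  NoNeighbourIn : (Fin n → Bool) → (Fin n → Fin q) → Fin n → Fin q → Set
  NoNeighbourIn C σ x a = ∀ u → C u ≡ true → adj G x u ≡ true → σ u ≢ a

  neighboursIn≡0⇒NoNeighbourIn : ∀ C σ x a → neighboursIn C σ x a ≡ 0 → NoNeighbourIn C σ x a
  neighboursIn≡0⇒NoNeighbourIn C σ x a none u Cu xu σu≡a =
    contradiction (trans (sym (cong 𝟙 counted)) (sum≡0⇒≡0 none u)) λ ()
    where
    counted : (adj G x u ∧ C u) ∧ ⌊ σ u ≟ a ⌋ ≡ true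
    counted = trans (cong₂ (λ b c → (b ∧ c) ∧ ⌊ σ u ≟ a ⌋) xu Cu) (⌊≟⌋-≡ σu≡a)

  ∑-inClass : ∀ C σ u (f : Fin q → ℕ) → ∑[ j < q ] (𝟙 (inClass C σ j u) * f j) ≡ 𝟙 (C u) * f (σ u)
  ∑-inClass C σ u f = trans (sum-single (σ u) other) (cong (λ b → 𝟙 b * f (σ u)) self)
    where
    self : inClass C σ (σ u) u ≡ C u
    self = trans (cong (C u ∧_) (⌊≟⌋-≡ refl)) (∧-identityʳ (C u))
    other : ∀ j → j ≢ σ u → 𝟙 (inClass C σ j u) * f j ≡ 0
    other j j≢σu rewrite ⌊≟⌋-≢ (j≢σu ∘ sym) | ∧-zeroʳ (C u) = refl

  ∑-classSize-weighted : ∀ C σ (f : Fin q → ℕ) →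
                         ∑[ j < q ] (classSize C σ j * f j) ≡ ∑[ u < n ] (𝟙 (C u) * f (σ u))
  ∑-classSize-weighted C σ f = begin
    ∑[ j < q ] (classSize C σ j * f j)
      ≡⟨ sum-cong-≗ {q} (λ j → *-distribʳ-sum (f j) (λ u → 𝟙 (inClass C σ j u))) ⟩
    ∑[ j < q ] ∑[ u < n ] (𝟙 (inClass C σ j u) * f j)
      ≡⟨ ∑-comm {q} {n} _ ⟩
    ∑[ u < n ] ∑[ j < q ] (𝟙 (inClass C σ j u) * f j)
      ≡⟨ sum-cong-≗ {n} (λ u → ∑-inClass C σ u f) ⟩
    ∑[ u < n ] (𝟙 (C u) * f (σ u))
      ∎
    where open ≡-Reasoning

  ∑-classSize : ∀ C σ → ∑[ j < q ] classSize C σ j ≡ ∑[ u < n ] 𝟙 (C u)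
  ∑-classSize C σ = begin
    ∑[ j < q ] classSize C σ j       ≡⟨ sum-cong-≗ {q} (λ j → *-identityʳ (classSize C σ j)) ⟨
    ∑[ j < q ] (classSize C σ j * 1) ≡⟨ ∑-classSize-weighted C σ (const 1) ⟩
    ∑[ u < n ] (𝟙 (C u) * 1)         ≡⟨ sum-cong-≗ {n} (λ u → *-identityʳ (𝟙 (C u))) ⟩
    ∑[ u < n ] 𝟙 (C u)               ∎
    where open ≡-Reasoning

  classSize-assign : ∀ C σ x a k →
    classSize (C [ x ]≔ true) (σ [ x ]≔ a) k + 𝟙 (inClass C σ k x) ≡ classSize C σ k + 𝟙 ⌊ a ≟ k ⌋
  classSize-assign C σ x a k = trans (sum-update x unchanged) (cong (λ b → classSize C σ k + 𝟙 b) changed)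
    where
    unchanged : ∀ u → u ≢ x → 𝟙 (inClass (C [ x ]≔ true) (σ [ x ]≔ a) k u) ≡ 𝟙 (inClass C σ k u)
    unchanged u u≢x =
      cong₂ (λ c s → 𝟙 (c ∧ ⌊ s ≟ k ⌋)) (updateAt-minimal u x C u≢x) (updateAt-minimal u x σ u≢x)
    changed : inClass (C [ x ]≔ true) (σ [ x ]≔ a) k x ≡ ⌊ a ≟ k ⌋
    changed = cong₂ (λ c s → c ∧ ⌊ s ≟ k ⌋) (updateAt-updates x C) (updateAt-updates x σ)

  uncoloured-assign : ∀ C x → uncoloured (C [ x ]≔ true) + 𝟙 (not (C x)) ≡ uncoloured C
  uncoloured-assign C x =
    trans (sum-update x unchanged) (trans (cong (λ c → uncoloured C + 𝟙 (not c)) (updateAt-updates x C)) (+-identityʳ _))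
    where
    unchanged : ∀ u → u ≢ x → 𝟙 (not ((C [ x ]≔ true) u)) ≡ 𝟙 (not (C u))
    unchanged u u≢x = cong (𝟙 ∘ not) (updateAt-minimal u x C u≢x)

  uncoloured-assign-≤ : ∀ C x → uncoloured (C [ x ]≔ true) ≤ uncoloured C
  uncoloured-assign-≤ C x = ≤-trans (m≤m+n _ _) (≤-reflexive (uncoloured-assign C x))

  uncoloured-assign-< : ∀ C x → C x ≡ false → uncoloured (C [ x ]≔ true) < uncoloured C
  uncoloured-assign-< C x Cx≡false =
    <-≤-trans (m<m+n _ (subst (λ c → 0 < 𝟙 (not c)) (sym Cx≡false) (s≤s z≤n))) (≤-reflexive (uncoloured-assign C x))

  classSize-colour : ∀ C σ x a k → C x ≡ false →
    classSize (C [ x ]≔ true) (σ [ x ]≔ a) k ≡ classSize C σ k + 𝟙 ⌊ a ≟ k ⌋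
  classSize-colour C σ x a k Cx≡false = begin
    classSize C' σ' k                       ≡⟨ +-identityʳ _ ⟨
    classSize C' σ' k + 0                   ≡⟨ cong (λ c → classSize C' σ' k + 𝟙 (c ∧ ⌊ σ x ≟ k ⌋)) Cx≡false ⟨
    classSize C' σ' k + 𝟙 (inClass C σ k x) ≡⟨ classSize-assign C σ x a k ⟩
    classSize C σ k + 𝟙 ⌊ a ≟ k ⌋           ∎
    where
    open ≡-Reasoning
    C' : Fin n → Bool
    C' = C [ x ]≔ true
    σ' : Fin n → Fin q
    σ' = σ [ x ]≔ a

  classSize-swap : ∀ C σ v w i k → C v ≡ false → C w ≡ true →
    classSize ((C [ v ]≔ true) [ w ]≔ true) ((σ [ v ]≔ σ w) [ w ]≔ i) k ≡ classSize C σ k + 𝟙 ⌊ i ≟ k ⌋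
  classSize-swap C σ v w i k Cv≡false Cw≡true = +-cancelʳ-≡ _ _ _ (begin
    classSize C₂ σ₂ k + δj                    ≡⟨ cong (λ b → classSize C₂ σ₂ k + 𝟙 b) w-inClass₁ ⟨
    classSize C₂ σ₂ k + 𝟙 (inClass C₁ σ₁ k w) ≡⟨ classSize-assign C₁ σ₁ w i k ⟩
    classSize C₁ σ₁ k + δi                    ≡⟨ cong (_+ δi) (classSize-colour C σ v (σ w) k Cv≡false) ⟩
    classSize C σ k + δj + δi                 ≡⟨ xy∙z≈xz∙y (classSize C σ k) δj δi ⟩
    classSize C σ k + δi + δj                 ∎)
    where
    open ≡-Reasoning
    C₁ C₂ : Fin n → Bool
    C₁ = C [ v ]≔ true
    C₂ = C₁ [ w ]≔ true
    σ₁ σ₂ : Fin n → Fin q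
    σ₁ = σ [ v ]≔ σ w
    σ₂ = σ₁ [ w ]≔ i
    δi δj : ℕ
    δi = 𝟙 ⌊ i ≟ k ⌋
    δj = 𝟙 ⌊ σ w ≟ k ⌋
    w≢v : w ≢ v
    w≢v refl = contradiction (trans (sym Cw≡true) Cv≡false) λ ()
    w-inClass₁ : inClass C₁ σ₁ k w ≡ ⌊ σ w ≟ k ⌋
    w-inClass₁ =
      cong₂ (λ c s → c ∧ ⌊ s ≟ k ⌋) (trans (updateAt-minimal w v C w≢v) Cw≡true) (updateAt-minimal w v σ w≢v)

  assign-proper : ∀ C σ x a → IsProperOn C σ → NoNeighbourIn C σ x a →
                  IsProperOn (C [ x ]≔ true) (σ [ x ]≔ a)
  assign-proper C σ x a proper free = proper'
    where
    was-coloured : ∀ {y} → y ≢ x → (C [ x ]≔ true) y ≡ true → C y ≡ true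
    was-coloured {y} y≢x = trans (sym (updateAt-minimal y x C y≢x))
    kept : ∀ {y} → y ≢ x → (σ [ x ]≔ a) y ≡ σ y
    kept {y} y≢x = updateAt-minimal y x σ y≢x
    new : (σ [ x ]≔ a) x ≡ a
    new = updateAt-updates x σ
    proper' : IsProperOn (C [ x ]≔ true) (σ [ x ]≔ a)
    proper' u w C'u C'w uw with u ≟ x | w ≟ x
    ... | yes refl | yes refl = contradiction (trans (sym uw) (irrefl G x)) λ ()
    ... | yes refl | no  w≢x  = λ σ'x≡σ'w →
      free w (was-coloured w≢x C'w) uw (trans (sym (kept w≢x)) (trans (sym σ'x≡σ'w) new))
    ... | no  u≢x  | yes refl = λ σ'u≡σ'x →
      free u (was-coloured u≢x C'u) (trans (Graph.sym G x u) uw) (trans (sym (kept u≢x)) (trans σ'u≡σ'x new))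
    ... | no  u≢x  | no  w≢x  = λ σ'u≡σ'w →
      proper u w (was-coloured u≢x C'u) (was-coloured w≢x C'w) uw (trans (sym (kept u≢x)) (trans σ'u≡σ'w (kept w≢x)))

degree≡∑ : (G : Graph n) (v : Fin n) → degree G v ≡ ∑[ u < n ] 𝟙 (adj G v u)
degree≡∑ G v = sum-map-allFin (𝟙 ∘ adj G v)

module BoundedDegree {n q : ℕ} (G : Graph n) (Δ : ℕ) (degree≤Δ : ∀ v → degree G v ≤ Δ) where

  open PartialColouring {n} {q} G

  ∑-neighbours-weighted≤ : ∀ (C : Fin n → Bool) x (f : Fin n → ℕ) M → (∀ u → f u ≤ M) →
                           ∑[ u < n ] (𝟙 (adj G x u ∧ C u) * f u) ≤ Δ * M
  ∑-neighbours-weighted≤ C x f M f≤M = begin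
    ∑[ u < n ] (𝟙 (adj G x u ∧ C u) * f u)
      ≤⟨ sum-mono-≤ (λ u → *-mono-≤ (𝟙-∧-≤ˡ (adj G x u) (C u)) (f≤M u)) ⟩
    ∑[ u < n ] (𝟙 (adj G x u) * M)
      ≡⟨ *-distribʳ-sum M (𝟙 ∘ adj G x) ⟨
    ∑[ u < n ] 𝟙 (adj G x u) * M
      ≡⟨ cong (_* M) (degree≡∑ G x) ⟨
    degree G x * M
      ≤⟨ *-monoˡ-≤ M (degree≤Δ x) ⟩
    Δ * M
      ∎
    where open ≤-Reasoning

  ∑-neighboursIn≤ : ∀ C σ j → ∑[ w < n ] neighboursIn C σ w j ≤ Δ * classSize C σ j
  ∑-neighboursIn≤ C σ j = begin
    ∑[ w < n ] neighboursIn C σ w j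
      ≡⟨ sum-cong-≗ {n} (λ w → sum-cong-≗ {n} (λ u → split w u)) ⟩
    ∑[ w < n ] ∑[ u < n ] (𝟙 (adj G w u) * member u)
      ≡⟨ ∑-comm {n} {n} _ ⟩
    ∑[ u < n ] ∑[ w < n ] (𝟙 (adj G w u) * member u)
      ≡⟨ sum-cong-≗ {n} (λ u → *-distribʳ-sum (member u) (λ w → 𝟙 (adj G w u))) ⟨
    ∑[ u < n ] (∑[ w < n ] 𝟙 (adj G w u) * member u)
      ≡⟨ sum-cong-≗ {n} (λ u → cong (_* member u) (degree-by-column u)) ⟨
    ∑[ u < n ] (degree G u * member u)
      ≤⟨ sum-mono-≤ (λ u → *-monoˡ-≤ (member u) (degree≤Δ u)) ⟩
    ∑[ u < n ] (Δ * member u)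
      ≡⟨ *-distribˡ-sum Δ member ⟨
    Δ * classSize C σ j
      ∎
    where
    open ≤-Reasoning
    member : Fin n → ℕ
    member u = 𝟙 (inClass C σ j u)
    split : ∀ w u → 𝟙 ((adj G w u ∧ C u) ∧ ⌊ σ u ≟ j ⌋) ≡ 𝟙 (adj G w u) * member u
    split w u = trans (cong 𝟙 (∧-assoc (adj G w u) (C u) _)) (𝟙-∧ (adj G w u) _)
    degree-by-column : ∀ u → degree G u ≡ ∑[ w < n ] 𝟙 (adj G w u)
    degree-by-column u = trans (degree≡∑ G u) (sum-cong-≗ {n} (λ w → cong 𝟙 (Graph.sym G u w)))

module VecColouring {n q : ℕ} (G : Graph n) (Δ : ℕ) .{{_ : NonZero Δ}} (degree≤Δ : ∀ v → degree G v ≤ Δ)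
                    (nv : Fin q → ℕ) (∑nv≡n : sum nv ≡ n) (2Δnv≤n : ∀ j → 2 * Δ * nv j ≤ n)
                    where

  open PartialColouring {n} {q} G
  open BoundedDegree {n} {q} G Δ degree≤Δ

  record IsPartialVecColouring (C : Fin n → Bool) (σ : Fin n → Fin q) : Set where
    field
      proper  : IsProperOn C σ
      bounded : ∀ k → classSize C σ k ≤ nv k

  deficient-colour : ∀ C σ v → C v ≡ false → ∃[ i ] classSize C σ i < nv i
  deficient-colour C σ v Cv≡false = sum-<⇒∃-< (begin-strict
    ∑[ j < q ] classSize C σ j ≡⟨ ∑-classSize C σ ⟩
    ∑[ u < n ] 𝟙 (C u)         <⟨ sum-mono-< (𝟙≤1 ∘ C) v (subst (λ c → 𝟙 c < 1) (sym Cv≡false) (s≤s z≤n)) ⟩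
    ∑[ u < n ] 1               ≡⟨ sum-const-1 n ⟩
    n                          ≡⟨ ∑nv≡n ⟨
    sum nv                     ∎)
    where open ≤-Reasoning

  2*∑-neighboursIn*nv≤n : ∀ C σ v → 2 * ∑[ j < q ] (neighboursIn C σ v j * nv j) ≤ n
  2*∑-neighboursIn*nv≤n C σ v = *-cancelˡ-≤ Δ (begin
    Δ * (2 * X)
      ≡⟨ reassociate Δ 2 X ⟩
    2 * Δ * X
      ≡⟨ cong (2 * Δ *_) (∑-classSize-weighted (λ u → adj G v u ∧ C u) σ nv) ⟩
    2 * Δ * ∑[ u < n ] (neighbour u * nv (σ u))
      ≡⟨ *-distribˡ-sum (2 * Δ) (λ u → neighbour u * nv (σ u)) ⟩
    ∑[ u < n ] (2 * Δ * (neighbour u * nv (σ u)))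
      ≡⟨ sum-cong-≗ {n} (λ u → x*[y*z]≡y*[x*z] (2 * Δ) (neighbour u) (nv (σ u))) ⟩
    ∑[ u < n ] (neighbour u * (2 * Δ * nv (σ u)))
      ≤⟨ ∑-neighbours-weighted≤ C v _ n (2Δnv≤n ∘ σ) ⟩
    Δ * n
      ∎)
    where
    open ≤-Reasoning
    X : ℕ
    X = ∑[ j < q ] (neighboursIn C σ v j * nv j)
    neighbour : Fin n → ℕ
    neighbour u = 𝟙 (adj G v u ∧ C u)
    reassociate : ∀ a b c → a * (b * c) ≡ b * a * c
    reassociate = solve-∀
    x*[y*z]≡y*[x*z] : ∀ a b c → a * (b * c) ≡ b * (a * c)
    x*[y*z]≡y*[x*z] = solve-∀

  n≤2*∑-free-coloured : ∀ C σ v → (∀ j → neighboursIn C σ v j ≡ 0 → nv j ≤ classSize C σ j) →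
                       n ≤ 2 * ∑[ w < n ] 𝟙 (C w ∧ (neighboursIn C σ v (σ w) ≡ᵇ 0))
  n≤2*∑-free-coloured C σ v full = +-cancelʳ-≤ (2 * X) n (2 * F) (begin
    n + 2 * X     ≤⟨ +-monoʳ-≤ n (2*∑-neighboursIn*nv≤n C σ v) ⟩
    n + n         ≡⟨ cong (n +_) (+-identityʳ n) ⟨
    2 * n         ≤⟨ *-monoʳ-≤ 2 n≤F+X ⟩
    2 * (F + X)   ≡⟨ *-distribˡ-+ 2 F X ⟩
    2 * F + 2 * X ∎)
    where
    open ≤-Reasoning
    free : Fin q → ℕ
    free j = 𝟙 (neighboursIn C σ v j ≡ᵇ 0)
    F X : ℕ
    F = ∑[ w < n ] 𝟙 (C w ∧ (neighboursIn C σ v (σ w) ≡ᵇ 0))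
    X = ∑[ j < q ] (neighboursIn C σ v j * nv j)
    split : ∀ a h → a ≤ a * 𝟙 (h ≡ᵇ 0) + h * a
    split a zero    = ≤-trans (≤-reflexive (sym (*-identityʳ a))) (m≤m+n (a * 1) 0)
    split a (suc h) = ≤-trans (m≤m+n a (h * a)) (m≤n+m _ (a * 0))
    full-weighted : ∀ j → nv j * free j ≤ classSize C σ j * free j
    full-weighted j with neighboursIn C σ v j | full j
    ... | zero  | full-j = *-monoˡ-≤ 1 (full-j refl)
    ... | suc _ | _      = ≤-reflexive (trans (*-zeroʳ (nv j)) (sym (*-zeroʳ (classSize C σ j))))
    n≤F+X : n ≤ F + X
    n≤F+X = begin
      n
        ≡⟨ ∑nv≡n ⟨
      sum nv
        ≤⟨ sum-mono-≤ (λ j → split (nv j) (neighboursIn C σ v j)) ⟩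
      ∑[ j < q ] (nv j * free j + neighboursIn C σ v j * nv j)
        ≡⟨ ∑-distrib-+ {q} (λ j → nv j * free j) _ ⟩
      ∑[ j < q ] (nv j * free j) + X
        ≤⟨ +-monoˡ-≤ X (sum-mono-≤ full-weighted) ⟩
      ∑[ j < q ] (classSize C σ j * free j) + X
        ≡⟨ cong (_+ X) (∑-classSize-weighted C σ free) ⟩
      ∑[ w < n ] (𝟙 (C w) * free (σ w)) + X
        ≡⟨ cong (_+ X) (sum-cong-≗ {n} (λ w → 𝟙-∧ (C w) _)) ⟨
      F + X
        ∎

  2*∑-adjacent-to-class<n : ∀ C σ i → classSize C σ i < nv i →
                            2 * ∑[ w < n ] 𝟙 (not (neighboursIn C σ w i ≡ᵇ 0)) < n
  2*∑-adjacent-to-class<n C σ i deficient = begin-strict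
    2 * ∑[ w < n ] 𝟙 (not (neighboursIn C σ w i ≡ᵇ 0)) ≤⟨ *-monoʳ-≤ 2 (sum-mono-≤ (λ w → 𝟙-not-≡ᵇ0 (neighboursIn C σ w i))) ⟩
    2 * ∑[ w < n ] neighboursIn C σ w i                ≤⟨ *-monoʳ-≤ 2 (∑-neighboursIn≤ C σ i) ⟩
    2 * (Δ * classSize C σ i)                          <⟨ *-monoʳ-< 2 (*-monoʳ-< Δ deficient) ⟩
    2 * (Δ * nv i)                                     ≡⟨ *-assoc 2 Δ (nv i) ⟨
    2 * Δ * nv i                                       ≤⟨ 2Δnv≤n i ⟩
    n                                                  ∎
    where
    open ≤-Reasoning
    𝟙-not-≡ᵇ0 : ∀ h → 𝟙 (not (h ≡ᵇ 0)) ≤ h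
    𝟙-not-≡ᵇ0 zero    = z≤n
    𝟙-not-≡ᵇ0 (suc h) = s≤s z≤n

  swappable-vertex : ∀ C σ v i → classSize C σ i < nv i →
                     (∀ j → neighboursIn C σ v j ≡ 0 → nv j ≤ classSize C σ j) →
                     ∃[ w ] C w ≡ true × neighboursIn C σ v (σ w) ≡ 0 × neighboursIn C σ w i ≡ 0
  swappable-vertex C σ v i deficient full
    with sum-<⇒∃-< (*-cancelˡ-< 2 _ _ (<-≤-trans (2*∑-adjacent-to-class<n C σ i deficient)
                                                 (n≤2*∑-free-coloured C σ v full)))
  ... | w , found with C w in Cw | neighboursIn C σ v (σ w) in free | neighboursIn C σ w i in untouched
  -- found forces C w ≡ true and both neighbour counts to vanish: the remaining cases are absurd.
  ... | true | zero | zero  = w , Cw , free , untouched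
  ... | true | zero | suc _ = contradiction found (<-irrefl refl)

  extend-by-free-colour : ∀ {C σ v j} → IsPartialVecColouring C σ → C v ≡ false →
                          classSize C σ j < nv j → neighboursIn C σ v j ≡ 0 →
                          IsPartialVecColouring (C [ v ]≔ true) (σ [ v ]≔ j)
  extend-by-free-colour {C} {σ} {v} {j} P Cv≡false deficient free = record
    { proper  = assign-proper C σ v j proper (neighboursIn≡0⇒NoNeighbourIn C σ v j free)
    ; bounded = λ k → subst (_≤ nv k) (sym (classSize-colour C σ v j k Cv≡false))
                            (add-at-deficient (classSize C σ) nv bounded j deficient k)
    }
    where open IsPartialVecColouring P

  extend-by-swap : ∀ {C σ v w i} → IsPartialVecColouring C σ → C v ≡ false → classSize C σ i < nv i →
                   C w ≡ true → σ w ≢ i → neighboursIn C σ v (σ w) ≡ 0 → neighboursIn C σ w i ≡ 0 →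
                   IsPartialVecColouring ((C [ v ]≔ true) [ w ]≔ true) ((σ [ v ]≔ σ w) [ w ]≔ i)
  extend-by-swap {C} {σ} {v} {w} {i} P Cv≡false deficient Cw≡true σw≢i free untouched = record
    { proper  = assign-proper C₁ σ₁ w i
                  (assign-proper C σ v (σ w) proper (neighboursIn≡0⇒NoNeighbourIn C σ v (σ w) free))
                  no-neighbour-in-i
    ; bounded = λ k → subst (_≤ nv k) (sym (classSize-swap C σ v w i k Cv≡false Cw≡true))
                            (add-at-deficient (classSize C σ) nv bounded i deficient k)
    }
    where
    open IsPartialVecColouring P
    C₁ : Fin n → Bool
    C₁ = C [ v ]≔ true
    σ₁ : Fin n → Fin q
    σ₁ = σ [ v ]≔ σ w
    no-neighbour-in-i : NoNeighbourIn C₁ σ₁ w i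
    no-neighbour-in-i u C₁u wu σ₁u≡i with u ≟ v
    ... | yes refl = σw≢i (trans (sym (updateAt-updates u σ)) σ₁u≡i)
    ... | no  u≢v  = neighboursIn≡0⇒NoNeighbourIn C σ w i untouched u
                       (trans (sym (updateAt-minimal u v C u≢v)) C₁u) wu
                       (trans (sym (updateAt-minimal u v σ u≢v)) σ₁u≡i)

  extend : ∀ {C σ v} → IsPartialVecColouring C σ → C v ≡ false →
           ∃[ C' ] ∃[ σ' ] IsPartialVecColouring C' σ' × uncoloured C' < uncoloured C
  extend {C} {σ} {v} P Cv≡false
    with any? (λ j → (classSize C σ j <? nv j) ×-dec (neighboursIn C σ v j ≟ℕ 0))
  ... | yes (j , deficient , free) =
    C [ v ]≔ true , σ [ v ]≔ j , extend-by-free-colour P Cv≡false deficient free , uncoloured-assign-< C v Cv≡false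
  ... | no no-free-deficient =
    let i , deficient = deficient-colour C σ v Cv≡false
        w , Cw≡true , free , untouched = swappable-vertex C σ v i deficient full
        σw≢i : σ w ≢ i
        σw≢i σw≡i = <⇒≱ deficient (full i (subst (λ j → neighboursIn C σ v j ≡ 0) σw≡i free))
    in (C [ v ]≔ true) [ w ]≔ true , (σ [ v ]≔ σ w) [ w ]≔ i ,
       extend-by-swap P Cv≡false deficient Cw≡true σw≢i free untouched ,
       ≤-<-trans (uncoloured-assign-≤ (C [ v ]≔ true) w) (uncoloured-assign-< C v Cv≡false)
    where
    full : ∀ j → neighboursIn C σ v j ≡ 0 → nv j ≤ classSize C σ j
    full j free = ≮⇒≥ (λ deficient → no-free-deficient (j , deficient , free))

  complete : ∀ {C σ} → IsPartialVecColouring C σ → (∀ u → C u ≡ true) → IsVecColoring G nv σ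
  complete {C} {σ} P coloured = (λ u w → proper u w (coloured u) (coloured w)) , exact
    where
    open IsPartialVecColouring P
    colorClassSize≡classSize : ∀ k → colorClassSize σ k ≡ classSize C σ k
    colorClassSize≡classSize k = trans (sum-map-allFin (λ u → 𝟙 ⌊ σ u ≟ k ⌋))
      (sum-cong-≗ {n} (λ u → cong (λ c → 𝟙 (c ∧ ⌊ σ u ≟ k ⌋)) (sym (coloured u))))
    ∑classSize≡∑nv : ∑[ k < q ] classSize C σ k ≡ sum nv
    ∑classSize≡∑nv = begin
      ∑[ k < q ] classSize C σ k ≡⟨ ∑-classSize C σ ⟩
      ∑[ u < n ] 𝟙 (C u)         ≡⟨ sum-cong-≗ {n} (cong 𝟙 ∘ coloured) ⟩
      ∑[ u < n ] 1               ≡⟨ sum-const-1 n ⟩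
      n                          ≡⟨ ∑nv≡n ⟨
      sum nv                     ∎
      where open ≡-Reasoning
    exact : ∀ k → colorClassSize σ k ≡ nv k
    exact k = trans (colorClassSize≡classSize k) (sum-mono-≡⇒≗ bounded ∑classSize≡∑nv k)

  colour-from : ∀ {C σ} k → uncoloured C ≤ k → IsPartialVecColouring C σ →
                ∃[ σ' ] IsVecColoring G nv σ'
  colour-from {C} {σ} k unc≤k P with any? (λ v → C v ≟ᴮ false)
  ... | no  none     = σ , complete P (λ v → ¬-not (none ∘ (v ,_)))
  ... | yes (v , Cv≡false) with extend P Cv≡false
  colour-from zero    unc≤0 P | yes _ | _ , _ , _ , unc'<unc  =
    contradiction (<-≤-trans unc'<unc unc≤0) n≮0
  colour-from (suc k) unc≤k P | yes _ | _ , _ , P' , unc'<unc =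
    colour-from k (≤-pred (<-≤-trans unc'<unc unc≤k)) P'

  vecColouring : Fin q → ∃[ σ ] IsVecColoring G nv σ
  vecColouring c = colour-from n (≤-reflexive (sum-const-1 n)) nothing-coloured
    where
    nothing-coloured : IsPartialVecColouring (const false) (const c)
    nothing-coloured = record
      { proper  = λ u w ()
      ; bounded = λ k → subst (_≤ nv k) (sym (sum-replicate-zero n)) z≤n
      }

balanced⇒2Δnv≤n : ∀ Δ q n .{{_ : NonZero q}} → 2 * Δ + 1 ≤ q → (nv : Fin q → ℕ) →
                  Balanced q n 1 (2 * Δ * q) nv → ∀ j → 2 * Δ * nv j ≤ n
balanced⇒2Δnv≤n Δ q n 2Δ+1≤q nv balanced j = *-cancelˡ-≤ q (begin
  q * (2 * Δ * x)                   ≡⟨ reassociate q (2 * Δ) x ⟩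
  2 * Δ * (q * x)                   ≤⟨ *-monoʳ-≤ (2 * Δ) (m≤∣m-n∣+n (q * x) n) ⟩
  2 * Δ * (∣ q * x - n ∣ + n)       ≡⟨ *-distribˡ-+ (2 * Δ) _ n ⟩
  2 * Δ * ∣ q * x - n ∣ + 2 * Δ * n ≤⟨ +-monoˡ-≤ (2 * Δ * n) deviation ⟩
  n + 2 * Δ * n                     ≡⟨ collect n (2 * Δ) ⟩
  (2 * Δ + 1) * n                   ≤⟨ *-monoˡ-≤ n 2Δ+1≤q ⟩
  q * n                             ∎)
  where
  open ≤-Reasoning
  x : ℕ
  x = nv j
  reassociate : ∀ a b c → a * (b * c) ≡ b * (a * c)
  reassociate = solve-∀
  collect : ∀ a b → a + b * a ≡ (b + 1) * a
  collect = solve-∀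
  deviation : 2 * Δ * ∣ q * x - n ∣ ≤ n
  deviation = *-cancelˡ-≤ q (subst₂ _≤_ (pull-q (2 * Δ) q _) (cong (_* n) (*-identityˡ q)) (balanced j))
    where
    pull-q : ∀ a b c → a * b * c ≡ b * (a * c)
    pull-q = solve-∀

mainTheorem3 : (Δ q : ℕ) → 1 ≤ Δ → 2 * Δ + 1 ≤ q →
    ∃[ a ] ∃[ b ] (1 ≤ a × 1 ≤ b × ∃[ N ] ((n : ℕ) → N ≤ n →
      (nv : Fin q → ℕ) → l1 q nv ≡ n → Balanced q n a b nv →
      (G : Graph n) → HasMaxDegree G Δ →
      ∃[ σ ] IsVecColoring G nv σ))
mainTheorem3 zero    _       ()        _
mainTheorem3 (suc _) zero    _         ()
mainTheorem3 Δ@(suc _) q@(suc _) _ 2Δ+1≤q = 1 , 2 * Δ * q , s≤s z≤n , s≤s z≤n , 0 , colourable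
  where
  colourable : (n : ℕ) → 0 ≤ n → (nv : Fin q → ℕ) → l1 q nv ≡ n → Balanced q n 1 (2 * Δ * q) nv →
               (G : Graph n) → HasMaxDegree G Δ → ∃[ σ ] IsVecColoring G nv σ
  colourable n _ nv l1≡n balanced G (degree≤Δ , _) =
    VecColouring.vecColouring G Δ degree≤Δ nv (trans (sym (sum-map-allFin nv)) l1≡n)
                              (balanced⇒2Δnv≤n Δ q n 2Δ+1≤q nv balanced) zero
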